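{- Let $\tau:$ SYNCSIMPLE $\to$ LOCKSIMPLE$_{k,IS}$ be a correct translation where $k \geq 2$. If $\tau(!)$ is of blocking type $P_i$ then $IS_i = \blacksquare$, and if $\tau(!)$ is of blocking type $P_iP_i$ then the first $i$-symbol is $T_i$, or $IS_i = \Box$; The same holds for $\tau(?)$.
   Context: SYNCSIMPLE: subprocesses $U ::= \checkmark \mid 0 \mid\ !U \mid\ ?U$; processes are parallel compositions (multisets) of subprocesses; reduction $!U_1 \mid ?U_2 \mid P \to U_1 \mid U_2 \mid P$; successful = has a parallel component $\checkmark$; may-convergent = reduces to a successful process; must-convergent = every reduct is may-convergent. LOCKSIMPLE$_{k,IS}$: $k$ locks, each full ($\blacksquare$) or empty ($\Box$), initial store $IS=(IS_1,\dots,IS_k)$; subprocesses $U ::= 0 \mid \checkmark \mid P_iU \mid T_iU$; $P_i$ on empty lock $i$ fills it, on a full lock blocks; $T_i$ never blocks and empties lock $i$. Convergence evaluated from $(P,IS)$. $\tau$ is compositional ($\tau(0)=0$, $\tau(\checkmark)=\checkmark$, $\tau$ commutes with parallel composition, $\tau(!U)=\tau(!)\tau(U)$, $\tau(?U)=\tau(?)\tau(U)$); correct = preserve and reflect may- and must-convergence. Blocking types of a sequence $S$ executed alone from $IS$: type $P_iP_i$ if $S$ has a prefix $R_1P_iR_2P_i$ with $R_2$ free of $P_i,T_i$ and execution deadlocks exactly before the last $P_i$; type $P_i$ if $S$ has a prefix $R_1P_i$ with $R_1$ free of $P_i,T_i$ and execution deadlocks exactly before this $P_i$. An "$i$-symbol"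 is an occurrence of $P_i$ or $T_i$. -}

module Defs where

open import Data.Nat using (ℕ)
open import Data.Fin using (Fin)
open import Data.List using (List; []; _∷_; _++_; map; concatMap)
open import Data.List.Relation.Unary.All using (All)
open import Data.List.Membership.Propositional using (_∈_)
open import Data.List.Relation.Binary.Permutation.Propositional using (_↭_)
open import Data.Vec using (Vec; lookup; _[_]≔_)
open import Data.Maybe using (Maybe; just; nothing)
open import Data.Product using (_×_; _,_; ∃; ∃-syntax; proj₁)
open import Function.Bundles using (_⇔_)
open import Relation.Binary.PropositionalEquality using (_≡_)
open import Relation.Binary.Construct.Closure.ReflexiveTransitive using (Star)
open import Relation.Nullary using (¬_)

-- Common: a subprocess is a finite sequence of prefix symbols followed
-- by an end marker 0 (nil) or ✓ (tick).  A process is a parallel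
-- composition (multiset) of subprocesses, represented as a list and
-- considered up to permutation (_↭_) in the reduction rules.

data End : Set where
  nil  : End
  tick : End

Sub : Set → Set
Sub A = List A × End

Successful : {A : Set} → List (Sub A) → Set
Successful P = ([] , tick) ∈ P

data SAct : Set where
  snd : SAct   -- !
  rcv : SAct   -- ?

SProc : Set
SProc = List (Sub SAct)

data SStep : SProc → SProc → Set where
  sync : ∀ {P} (u₁ : List SAct) (e₁ : End) (u₂ : List SAct) (e₂ : End) (R : SProc) →
         P ↭ ((snd ∷ u₁ , e₁) ∷ (rcv ∷ u₂ , e₂) ∷ R) →
         SStep P ((u₁ , e₁) ∷ (u₂ , e₂) ∷ R)

MayS : SProc → Set
MayS P = ∃[ Q ] (Star SStep P Q × Successful Q)

MustS : SProc → Set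
MustS P = ∀ Q → Star SStep P Q → MayS Q

data Lock : Set where
  full  : Lock   -- ■
  empty : Lock   -- □

data LSym (k : ℕ) : Set where
  P : Fin k → LSym k
  T : Fin k → LSym k

Store : ℕ → Set
Store k = Vec Lock k

putOn : {k : ℕ} → Store k → Fin k → Lock → Maybe (Store k)
putOn s i full  = nothing
putOn s i empty = just (s [ i ]≔ full)

exec : {k : ℕ} → Store k → LSym k → Maybe (Store k)
exec s (P i) = putOn s i (lookup s i)
exec s (T i) = just (s [ i ]≔ empty)

LProc : ℕ → Set
LProc k = List (Sub (LSym k))

LConf : ℕ → Set
LConf k = LProc k × Store k

data LStep {k : ℕ} : LConf k → LConf k → Set where
  step : ∀ {Pr s s'} (a : LSym k) (w : List (LSym k)) (e : End) (R : LProc k) →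
         Pr ↭ ((a ∷ w , e) ∷ R) → exec s a ≡ just s' →
         LStep (Pr , s) ((w , e) ∷ R , s')

MayL : {k : ℕ} → LConf k → Set
MayL C = ∃[ D ] (Star LStep C D × Successful (proj₁ D))

MustL : {k : ℕ} → LConf k → Set
MustL C = ∀ D → Star LStep C D → MayL D

-- Compositional translations SYNCSIMPLE → LOCKSIMPLE_k: determined by
-- the words τ(!) and τ(?); τ(0)=0, τ(✓)=✓, τ(!U)=τ(!)τ(U), τ(?U)=τ(?)τ(U),
-- and τ commutes with parallel composition.

record Translation (k : ℕ) : Set where
  field
    τ! : List (LSym k)
    τ? : List (LSym k)

  trAct : SAct → List (LSym k)
  trAct snd = τ!
  trAct rcv = τ?

  trSub : Sub SAct → Sub (LSym k)
  trSub (w , e) = (concatMap trAct w , e)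

  trProc : SProc → LProc k
  trProc = map trSub

open Translation public

Correct : {k : ℕ} → Translation k → Store k → Set
Correct τ IS = ∀ (Pr : SProc) →
  (MayS Pr ⇔ MayL (trProc τ Pr , IS)) × (MustS Pr ⇔ MustL (trProc τ Pr , IS))

-- executing a word alone from a store; nothing = deadlock
run : {k : ℕ} → Store k → List (LSym k) → Maybe (Store k)
run s [] = just s
run s (a ∷ w) with exec s a
... | nothing = nothing
... | just s' = run s' w

data IsISym {k : ℕ} (i : Fin k) : LSym k → Set where
  isP : IsISym i (P i)
  isT : IsISym i (T i)

NoISym : {k : ℕ} → Fin k → List (LSym k) → Set
NoISym i w = All (λ a → ¬ IsISym i a) w

DeadlocksBefore : {k : ℕ} → Store k → List (LSym k) → Fin k → Set
DeadlocksBefore IS R i = ∃[ s ] (run IS R ≡ just s × exec s (P i) ≡ nothing)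

BlockTypeP : {k : ℕ} → Store k → List (LSym k) → Fin k → Set
BlockTypeP IS S i = ∃[ R₁ ] ∃[ R₂ ]
  (S ≡ R₁ ++ (P i ∷ R₂) × NoISym i R₁ × DeadlocksBefore IS R₁ i)

BlockTypePP : {k : ℕ} → Store k → List (LSym k) → Fin k → Set
BlockTypePP IS S i = ∃[ R₁ ] ∃[ R₂ ] ∃[ R₃ ]
  (S ≡ R₁ ++ (P i ∷ R₂ ++ (P i ∷ R₃)) × NoISym i R₂ ×
   DeadlocksBefore IS (R₁ ++ (P i ∷ R₂)) i)

FirstISymIsT : {k : ℕ} → List (LSym k) → Fin k → Set
FirstISymIsT S i = ∃[ R₁ ] ∃[ R₂ ] (S ≡ R₁ ++ (T i ∷ R₂) × NoISym i R₁)

-- Both parts are properties of the word alone.  Lock i is untouched by symbols other than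
-- i-symbols.  For type P_i, the i-free prefix before the blocking P_i leaves
-- lock i as in IS, and P_i blocks only on a full lock.  For type P_iP_i, the
-- prefix up to the blocking P_i ran through an earlier P_i; if lock i started
-- full and the first i-symbol were P_i, the run would already have blocked
-- there, so the first i-symbol is T_i.
module Submission where

open import Defs
open import Data.Nat using (ℕ; _≤_)
open import Data.Fin using (Fin)
open import Data.Fin.Properties using (_≟_)
open import Data.Vec using (Vec; lookup)
open import Data.Vec.Properties using (lookup∘update′)
open import Data.List using (List; []; _∷_; _++_)
open import Data.List.Properties using (++-assoc)
open import Data.List.Relation.Unary.All using ([]; _∷_)
open import Data.List.Relation.Unary.All.Properties using (++⁻ʳ)
open import Data.Maybe using (just; nothing; _>>=_)
open import Data.Product using (_×_; _,_; ∃-syntax)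
open import Data.Sum using (_⊎_; inj₁; inj₂)
open import Data.Empty using (⊥-elim)
open import Relation.Nullary using (¬_; Dec; yes; no)
open import Relation.Binary.PropositionalEquality using (_≡_; refl; sym; trans; subst)

run-++ : ∀ {k} (s : Store k) (u v : List (LSym k)) →
         run s (u ++ v) ≡ (run s u >>= λ t → run t v)
run-++ s []      v = refl
run-++ s (a ∷ u) v with exec s a
... | nothing = refl
... | just t  = run-++ t u v

module _ {k : ℕ} (i : Fin k) where

  FirstISymIsP : List (LSym k) → Set
  FirstISymIsP S = ∃[ R₁ ] ∃[ R₂ ] (S ≡ R₁ ++ (P i ∷ R₂) × NoISym i R₁)

  isISym? : (a : LSym k) → Dec (IsISym i a)
  isISym? (P j) with j ≟ i
  ... | yes refl = yes isP
  ... | no j≢i   = no λ { isP → j≢i refl }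
  isISym? (T j) with j ≟ i
  ... | yes refl = yes isT
  ... | no j≢i   = no λ { isT → j≢i refl }

  first-i-symbol : (w : List (LSym k)) → NoISym i w ⊎ FirstISymIsT w i ⊎ FirstISymIsP w
  first-i-symbol []      = inj₁ []
  first-i-symbol (a ∷ w) with isISym? a
  ... | yes isP = inj₂ (inj₂ ([] , w , refl , []))
  ... | yes isT = inj₂ (inj₁ ([] , w , refl , []))
  ... | no ¬a with first-i-symbol w
  ...   | inj₁ ¬w                              = inj₁ (¬a ∷ ¬w)
  ...   | inj₂ (inj₁ (R₁ , R₂ , refl , ¬R₁)) = inj₂ (inj₁ (a ∷ R₁ , R₂ , refl , ¬a ∷ ¬R₁))
  ...   | inj₂ (inj₂ (R₁ , R₂ , refl , ¬R₁)) = inj₂ (inj₂ (a ∷ R₁ , R₂ , refl , ¬a ∷ ¬R₁))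

  ¬NoISym-++-P : (R₁ R₂ : List (LSym k)) → ¬ NoISym i (R₁ ++ (P i ∷ R₂))
  ¬NoISym-++-P R₁ R₂ ¬w with ++⁻ʳ R₁ ¬w
  ... | ¬Pi ∷ _ = ¬Pi isP

  FirstISymIsT-++ : (w v : List (LSym k)) → FirstISymIsT w i → FirstISymIsT (w ++ v) i
  FirstISymIsT-++ w v (R₁ , R₂ , refl , ¬R₁) = R₁ , R₂ ++ v , ++-assoc R₁ (T i ∷ R₂) v , ¬R₁

  lookup-exec-¬IsISym : ∀ {s s' : Store k} (a : LSym k) → ¬ IsISym i a →
                        exec s a ≡ just s' → lookup s' i ≡ lookup s i
  lookup-exec-¬IsISym {s} (P j) ¬a e with lookup s j
  ... | empty with refl ← e = lookup∘update′ (λ { refl → ¬a isP }) s full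
  ... | full  with () ← e
  lookup-exec-¬IsISym {s} (T j) ¬a refl = lookup∘update′ (λ { refl → ¬a isT }) s empty

  lookup-run-NoISym : ∀ {s s' : Store k} (w : List (LSym k)) → NoISym i w →
                      run s w ≡ just s' → lookup s' i ≡ lookup s i
  lookup-run-NoISym     []      []        refl = refl
  lookup-run-NoISym {s} (a ∷ w) (¬a ∷ ¬w) r with exec s a in e
  ... | just t = trans (lookup-run-NoISym w ¬w r) (lookup-exec-¬IsISym a ¬a e)

  exec-P≡nothing⇒full : ∀ (s : Store k) → exec s (P i) ≡ nothing → lookup s i ≡ full
  exec-P≡nothing⇒full s e with lookup s i
  ... | full = refl

  run-FirstISymIsP-full : ∀ (s : Store k) (w : List (LSym k)) → lookup s i ≡ full →
                          FirstISymIsP w → run s w ≡ nothing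
  run-FirstISymIsP-full s w full-i (R₁ , R₂ , refl , ¬R₁)
    rewrite run-++ s R₁ (P i ∷ R₂) with run s R₁ in r
  ... | nothing = refl
  ... | just t rewrite trans (lookup-run-NoISym R₁ ¬R₁ r) full-i = refl

  BlockTypeP⇒full : ∀ (IS : Store k) (S : List (LSym k)) → BlockTypeP IS S i → lookup IS i ≡ full
  BlockTypeP⇒full IS S (R₁ , _ , _ , ¬R₁ , s , r , e) =
    trans (sym (lookup-run-NoISym R₁ ¬R₁ r)) (exec-P≡nothing⇒full s e)

  BlockTypePP⇒FirstISymIsT⊎empty : ∀ (IS : Store k) (S : List (LSym k)) → BlockTypePP IS S i →
                                    FirstISymIsT S i ⊎ lookup IS i ≡ empty
  BlockTypePP⇒FirstISymIsT⊎empty IS S (R₁ , R₂ , R₃ , refl , _ , s , r , _) with lookup IS i in IS-i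
  ... | empty = inj₂ refl
  ... | full with first-i-symbol (R₁ ++ (P i ∷ R₂))
  ...   | inj₁ ¬w = ⊥-elim (¬NoISym-++-P R₁ R₂ ¬w)
  ...   | inj₂ (inj₂ firstP) with () ← trans (sym r) (run-FirstISymIsP-full IS _ IS-i firstP)
  ...   | inj₂ (inj₁ firstT) = inj₁ (subst (λ S → FirstISymIsT S i)
                                         (++-assoc R₁ (P i ∷ R₂) (P i ∷ R₃))
                                         (FirstISymIsT-++ _ (P i ∷ R₃) firstT))

lemma4p5 : (k : ℕ) (IS : Vec Lock k) (τ : Translation k) → 2 ≤ k → Correct τ IS →
    (∀ (i : Fin k) →
      (BlockTypeP IS (τ! τ) i → lookup IS i ≡ full) ×
      (BlockTypePP IS (τ! τ) i → FirstISymIsT (τ! τ) i ⊎ lookup IS i ≡ empty)) ×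
    (∀ (i : Fin k) →
      (BlockTypeP IS (τ? τ) i → lookup IS i ≡ full) ×
      (BlockTypePP IS (τ? τ) i → FirstISymIsT (τ? τ) i ⊎ lookup IS i ≡ empty))
lemma4p5 k IS τ _ _ = blocking-types (τ! τ) , blocking-types (τ? τ)
  where
  blocking-types : (S : List (LSym k)) → ∀ i →
    (BlockTypeP IS S i → lookup IS i ≡ full) ×
    (BlockTypePP IS S i → FirstISymIsT S i ⊎ lookup IS i ≡ empty)
  blocking-types S i = BlockTypeP⇒full i IS S , BlockTypePP⇒FirstISymIsT⊎empty i IS S
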